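{- Let $m\ge1$, let $k_1,\dots,k_m$ be positive odd integers and fix $\varepsilon_1,\dots,\varepsilon_m\in\mathbb Z/2\mathbb Z$. Then there is an odd polynomial $p$ of degree $k_1+\dots+k_m+m-1$ such that for every positive integer $n\equiv\varepsilon_1+\dots+\varepsilon_m\pmod2$, \[ \sum_{\substack{i_1,\dots,i_m\ge1,\ i_1+\dots+i_m=n\\ i_r\equiv\varepsilon_r\ (\mathrm{mod}\ 2)\ \forall r}}i_1^{k_1}i_2^{k_2}\cdots i_m^{k_m}=p(n), \] and the leading coefficient of $p$ does not depend on the choice of $(\varepsilon_1,\dots,\varepsilon_m)$. -}

module Defs where

open import Data.Nat using (ℕ; zero; suc; _+_; _*_; _^_; _%_; _∸_)
open import Data.Nat.Base using (_≡ᵇ_)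
open import Data.Bool using (if_then_else_)
open import Data.Fin using (Fin; toℕ)
open import Data.Vec using (Vec; []; _∷_)
open import Data.Integer using (+_)
open import Data.Rational using (ℚ; 0ℚ; _/_)
import Data.Rational as ℚ

sumFrom1 : ℕ → (ℕ → ℕ) → ℕ
sumFrom1 zero    f = 0
sumFrom1 (suc n) f = sumFrom1 n f + f (suc n)

-- compSum ks εs n  =  Σ over (i₁,…,i_m) with all iᵣ ≥ 1, i₁+…+i_m = n,
--                      iᵣ ≡ εᵣ (mod 2), of  i₁^k₁ ⋯ i_m^k_m.
-- Recursion on the first part i₁ ∈ {1,…,n}.
compSum : ∀ {m} → Vec ℕ m → Vec (Fin 2) m → ℕ → ℕ
compSum []       []       n = if n ≡ᵇ 0 then 1 else 0
compSum (k ∷ ks) (e ∷ es) n =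
  sumFrom1 n (λ i → if (i % 2) ≡ᵇ toℕ e then i ^ k * compSum ks es (n ∸ i) else 0)

vsum : ∀ {m} → Vec ℕ m → ℕ
vsum []       = 0
vsum (x ∷ xs) = x + vsum xs

εsum : ∀ {m} → Vec (Fin 2) m → ℕ
εsum []       = 0
εsum (e ∷ es) = toℕ e + εsum es

ℕtoℚ : ℕ → ℚ
ℕtoℚ n = (+ n) / 1

-- Polynomial given by coefficient vector (a₀, a₁, …, a_d), evaluated by Horner:
-- eval (a₀ ∷ as) x = a₀ + x * eval as x,  so index i holds the coefficient of x^i.
evalPoly : ∀ {l} → Vec ℚ l → ℚ → ℚ
evalPoly []       x = 0ℚ
evalPoly (a ∷ as) x = a ℚ.+ x ℚ.* evalPoly as x

module Submission where

-- Splitting off the first part, S(n) = Σ_{i ≡ ε₁} i^k₁ S′(n - i), where by induction S′ agrees on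
-- its parity class with an odd polynomial Q of degree d and positive top coefficient γ. For each x
-- take a step-2 antidifference G x of y ↦ y^k₁ Q(x - y), built by induction on Q so that
-- G x (x + b) and G x b are polynomials in x. Telescoping gives S(n) = G n (n + 2 - ρ) - G n (2 - ε₁),
-- ρ the parity of ε₂ + ⋯ + εₘ: a polynomial of degree k₁ + d + 1 with top coefficient
-- γ β(k₁, d) > 0, whatever the parities. Since y^k₁ and Q are odd, y ↦ - G (- x) (2 - y) is another
-- antidifference of the same function, so the two differ by a 2-periodic function; comparing them
-- at integers of the right parity shows that this polynomial is odd at every admissible n, hence
-- agrees there with its odd part.

module _ where
  open import Data.Bool as Bool using (Bool; true; false; if_then_else_)
  open import Data.Fin using (Fin; toℕ; fromℕ) renaming (zero to fzero; suc to fsuc)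
  open import Data.Fin.Properties using (toℕ-fromℕ; toℕ<n)
  import Data.Integer as ℤ
  import Data.Integer.Properties as ℤ
  open import Data.Nat as ℕ using (ℕ; zero; suc; _∸_; _%_; _≡ᵇ_; _≤_; _<_; s≤s)
  import Data.Nat.Properties as ℕ
  import Data.Nat.Tactic.RingSolver as ℕ-Solver
  open import Data.Nat.Coprimality using (1-coprimeTo) renaming (sym to coprime-sym)
  open import Data.Nat.DivMod using (%-distribˡ-+; m%n%n≡m%n; m%n<n; [m+kn]%n≡m%n)
  open import Data.Product using (Σ; ∃; _×_; _,_; proj₁; proj₂)
  open import Data.Rational using (ℚ; mkℚ; 0ℚ; 1ℚ; ½; _+_; _*_; -_; _-_; 1/_; Positive; NonZero)
  open import Data.Rational.Properties
    using (_≟_; +-*-commutativeRing; +-identityˡ; +-identityʳ; *-identityʳ; *-zeroˡ; *-zeroʳ; +-inverseʳ; normalize-coprime; /-cong; pos⇒nonZero; 1/pos⇒pos; pos*pos⇒pos; *-inverseʳ)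
  open import Data.Sum using (_⊎_; inj₁; inj₂)
  open import Function using (_∘_)
  open import Data.Vec using (Vec; []; _∷_; lookup)
  open import Data.Vec.Relation.Unary.All using (All; []; _∷_)
  open import Level using (0ℓ)
  open import Relation.Binary.PropositionalEquality
  open import Relation.Nullary.Decidable using (dec⇒maybe)
  open import Tactic.RingSolver using (solve-∀)
  open import Tactic.RingSolver.Core.AlmostCommutativeRing using (AlmostCommutativeRing; fromCommutativeRing)

  open import Defs

  ℚ-ring : AlmostCommutativeRing 0ℓ 0ℓ
  ℚ-ring = fromCommutativeRing +-*-commutativeRing (λ x → dec⇒maybe (0ℚ ≟ x))

  2ℚ : ℚ
  2ℚ = 1ℚ + 1ℚ

  infixr 8 _^_

  _^_ : ℚ → ℕ → ℚ
  x ^ zero  = 1ℚ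
  x ^ suc n = x * x ^ n

  ℕtoℚ-canonical : ∀ n → ℕtoℚ n ≡ mkℚ (ℤ.+ n) 0 (coprime-sym (1-coprimeTo n))
  ℕtoℚ-canonical n = normalize-coprime (coprime-sym (1-coprimeTo n))

  ℕtoℚ-suc : ∀ n → ℕtoℚ (suc n) ≡ ℕtoℚ n + 1ℚ
  ℕtoℚ-suc n rewrite ℕtoℚ-canonical n = /-cong numerators refl
    where
    numerators : ℤ.+ suc n ≡ (ℤ.+ n) ℤ.* (ℤ.+ 1) ℤ.+ (ℤ.+ 1) ℤ.* (ℤ.+ 1)
    numerators rewrite ℤ.*-identityʳ (ℤ.+ n) = cong ℤ.+_ (ℕ.+-comm 1 n)

  ℕtoℚ-+ : ∀ m n → ℕtoℚ (m ℕ.+ n) ≡ ℕtoℚ m + ℕtoℚ n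
  ℕtoℚ-+ zero    n = sym (+-identityˡ (ℕtoℚ n))
  ℕtoℚ-+ (suc m) n = begin
    ℕtoℚ (suc (m ℕ.+ n))     ≡⟨ ℕtoℚ-suc (m ℕ.+ n) ⟩
    ℕtoℚ (m ℕ.+ n) + 1ℚ      ≡⟨ cong (_+ 1ℚ) (ℕtoℚ-+ m n) ⟩
    ℕtoℚ m + ℕtoℚ n + 1ℚ     ≡⟨ swap (ℕtoℚ m) (ℕtoℚ n) ⟩
    (ℕtoℚ m + 1ℚ) + ℕtoℚ n   ≡⟨ cong (_+ ℕtoℚ n) (ℕtoℚ-suc m) ⟨
    ℕtoℚ (suc m) + ℕtoℚ n    ∎
    where
    open ≡-Reasoning
    swap : ∀ x y → x + y + 1ℚ ≡ (x + 1ℚ) + y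
    swap = solve-∀ ℚ-ring

  ℕtoℚ-* : ∀ m n → ℕtoℚ (m ℕ.* n) ≡ ℕtoℚ m * ℕtoℚ n
  ℕtoℚ-* zero    n = sym (*-zeroˡ (ℕtoℚ n))
  ℕtoℚ-* (suc m) n = begin
    ℕtoℚ (n ℕ.+ m ℕ.* n)         ≡⟨ ℕtoℚ-+ n (m ℕ.* n) ⟩
    ℕtoℚ n + ℕtoℚ (m ℕ.* n)      ≡⟨ cong (ℕtoℚ n +_) (ℕtoℚ-* m n) ⟩
    ℕtoℚ n + ℕtoℚ m * ℕtoℚ n     ≡⟨ distrib (ℕtoℚ m) (ℕtoℚ n) ⟩
    (ℕtoℚ m + 1ℚ) * ℕtoℚ n       ≡⟨ cong (_* ℕtoℚ n) (ℕtoℚ-suc m) ⟨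
    ℕtoℚ (suc m) * ℕtoℚ n        ∎
    where
    open ≡-Reasoning
    distrib : ∀ x y → y + x * y ≡ (x + 1ℚ) * y
    distrib = solve-∀ ℚ-ring

  ℕtoℚ-∸ : ∀ {m n} → n ≤ m → ℕtoℚ (m ∸ n) ≡ ℕtoℚ m - ℕtoℚ n
  ℕtoℚ-∸ {m} {n} n≤m = begin
    ℕtoℚ (m ∸ n)                          ≡⟨ cancel (ℕtoℚ (m ∸ n)) (ℕtoℚ n) ⟩
    (ℕtoℚ n + ℕtoℚ (m ∸ n)) - ℕtoℚ n      ≡⟨ cong (_- ℕtoℚ n) (ℕtoℚ-+ n (m ∸ n)) ⟨
    ℕtoℚ (n ℕ.+ (m ∸ n)) - ℕtoℚ n         ≡⟨ cong (λ z → ℕtoℚ z - ℕtoℚ n) (ℕ.m+[n∸m]≡n n≤m) ⟩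
    ℕtoℚ m - ℕtoℚ n                       ∎
    where
    open ≡-Reasoning
    cancel : ∀ x y → x ≡ (y + x) - y
    cancel = solve-∀ ℚ-ring

  ℕtoℚ-^ : ∀ i k → ℕtoℚ (i ℕ.^ k) ≡ ℕtoℚ i ^ k
  ℕtoℚ-^ i zero    = refl
  ℕtoℚ-^ i (suc k) = trans (ℕtoℚ-* i (i ℕ.^ k)) (cong (ℕtoℚ i *_) (ℕtoℚ-^ i k))

  ℕtoℚ-2+ : ∀ n → ℕtoℚ (2 ℕ.+ n) ≡ ℕtoℚ n + 2ℚ
  ℕtoℚ-2+ n = begin
    ℕtoℚ (suc (suc n))     ≡⟨ ℕtoℚ-suc (suc n) ⟩
    ℕtoℚ (suc n) + 1ℚ      ≡⟨ cong (_+ 1ℚ) (ℕtoℚ-suc n) ⟩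
    ℕtoℚ n + 1ℚ + 1ℚ       ≡⟨ +-assoc (ℕtoℚ n) ⟩
    ℕtoℚ n + 2ℚ            ∎
    where
    open ≡-Reasoning
    +-assoc : ∀ x → x + 1ℚ + 1ℚ ≡ x + 2ℚ
    +-assoc = solve-∀ ℚ-ring

  ℕtoℚ-suc-positive : ∀ n → Positive (ℕtoℚ (suc n))
  ℕtoℚ-suc-positive n = subst Positive (sym (ℕtoℚ-canonical (suc n))) _

  ℕtoℚ-suc-nonZero : ∀ n → NonZero (ℕtoℚ (suc n))
  ℕtoℚ-suc-nonZero n = pos⇒nonZero (ℕtoℚ (suc n)) {{ℕtoℚ-suc-positive n}}

  1/suc : ℕ → ℚ
  1/suc n = (1/ ℕtoℚ (suc n)) {{ℕtoℚ-suc-nonZero n}}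

  1/suc-positive : ∀ n → Positive (1/suc n)
  1/suc-positive n = 1/pos⇒pos (ℕtoℚ (suc n)) {{ℕtoℚ-suc-positive n}}

  1/suc-inverseʳ : ∀ n → ℕtoℚ (suc n) * 1/suc n ≡ 1ℚ
  1/suc-inverseʳ n = *-inverseʳ (ℕtoℚ (suc n)) {{ℕtoℚ-suc-nonZero n}}

  -- Polynomial functions

  -- Poly d c f : f is a polynomial function of degree at most d whose coefficient of xᵈ is c.
  data Poly : ℕ → ℚ → (ℚ → ℚ) → Set where
    constant : ∀ {c f} → (∀ x → f x ≡ c) → Poly 0 c f
    horner   : ∀ {d c f} (a : ℚ) (g : ℚ → ℚ) → Poly d c g → (∀ x → f x ≡ a + x * g x) → Poly (suc d) c f

  private variable
    d d′ : ℕ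
    c c′ : ℚ
    f g : ℚ → ℚ

  Poly-ext : Poly d c f → (∀ x → f x ≡ g x) → Poly d c g
  Poly-ext (constant f≡c)     f≡g = constant (λ x → trans (sym (f≡g x)) (f≡c x))
  Poly-ext (horner a h P f≡) f≡g = horner a h P (λ x → trans (sym (f≡g x)) (f≡ x))

  Poly-leading-cong : c ≡ c′ → Poly d c f → Poly d c′ f
  Poly-leading-cong refl P = P

  Poly-degree-cong : d ≡ d′ → Poly d c f → Poly d′ c f
  Poly-degree-cong refl P = P

  Poly-const : ∀ a → Poly 0 a (λ _ → a)
  Poly-const a = constant (λ _ → refl)

  +-*-zeroʳ : ∀ a x → a + x * 0ℚ ≡ a
  +-*-zeroʳ a x = trans (cong (a +_) (*-zeroʳ x)) (+-identityʳ a)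

  Poly-raise : Poly d c f → Poly (suc d) 0ℚ f
  Poly-raise {c = c} (constant f≡c) = horner c (λ _ → 0ℚ) (Poly-const 0ℚ) (λ x → trans (f≡c x) (sym (+-*-zeroʳ c x)))
  Poly-raise (horner a h P f≡) = horner a h (Poly-raise P) f≡

  Poly-raise-by : ∀ k → Poly d c f → Poly (suc (k ℕ.+ d)) 0ℚ f
  Poly-raise-by zero    P = Poly-raise P
  Poly-raise-by (suc k) P = Poly-raise (Poly-raise-by k P)

  Poly-lower : Poly (suc d) 0ℚ f → ∃ λ c → Poly d c f
  Poly-lower {zero}  (horner a h (constant h≡0) f≡) =
    a , constant (λ x → trans (f≡ x) (trans (cong (λ z → a + x * z) (h≡0 x)) (+-*-zeroʳ a x)))
  Poly-lower {suc d} (horner a h P f≡) = proj₁ (Poly-lower P) , horner a h (proj₂ (Poly-lower P)) f≡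

  Poly-add : Poly d c f → Poly d c′ g → Poly d (c + c′) (λ x → f x + g x)
  Poly-add (constant f≡) (constant g≡) = constant (λ x → cong₂ _+_ (f≡ x) (g≡ x))
  Poly-add (horner a f′ P f≡) (horner b g′ Q g≡) =
    horner (a + b) (λ x → f′ x + g′ x) (Poly-add P Q)
      (λ x → trans (cong₂ _+_ (f≡ x) (g≡ x)) (regroup a b x (f′ x) (g′ x)))
    where regroup : ∀ a b x u v → (a + x * u) + (b + x * v) ≡ (a + b) + x * (u + v)
          regroup = solve-∀ ℚ-ring

  Poly-sub : Poly d c f → Poly d c′ g → Poly d (c - c′) (λ x → f x - g x)
  Poly-sub (constant f≡) (constant g≡) = constant (λ x → cong₂ _-_ (f≡ x) (g≡ x))
  Poly-sub (horner a f′ P f≡) (horner b g′ Q g≡) =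
    horner (a - b) (λ x → f′ x - g′ x) (Poly-sub P Q)
      (λ x → trans (cong₂ _-_ (f≡ x) (g≡ x)) (regroup a b x (f′ x) (g′ x)))
    where regroup : ∀ a b x u v → (a + x * u) - (b + x * v) ≡ (a - b) + x * (u - v)
          regroup = solve-∀ ℚ-ring

  Poly-scale : ∀ a → Poly d c f → Poly d (a * c) (λ x → a * f x)
  Poly-scale a (constant f≡) = constant (λ x → cong (a *_) (f≡ x))
  Poly-scale a (horner b f′ P f≡) =
    horner (a * b) (λ x → a * f′ x) (Poly-scale a P) (λ x → trans (cong (a *_) (f≡ x)) (distrib a b x (f′ x)))
    where distrib : ∀ a b x u → a * (b + x * u) ≡ a * b + x * (a * u)
          distrib = solve-∀ ℚ-ring

  Poly-mulX : Poly d c f → Poly (suc d) c (λ x → x * f x)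
  Poly-mulX {f = f} P = horner 0ℚ f P (λ x → sym (+-identityˡ (x * f x)))

  Poly-^ : ∀ n → Poly n 1ℚ (_^ n)
  Poly-^ zero    = Poly-const 1ℚ
  Poly-^ (suc n) = Poly-mulX (Poly-^ n)

  Poly-add-const : ∀ a → Poly (suc d) c f → Poly (suc d) c (λ x → a + f x)
  Poly-add-const a (horner b f′ P f≡) =
    horner (a + b) f′ P (λ x → trans (cong (a +_) (f≡ x)) (+-assoc a b (x * f′ x)))
    where +-assoc : ∀ a b u → a + (b + u) ≡ (a + b) + u
          +-assoc = solve-∀ ℚ-ring

  Poly-shift : ∀ b → Poly d c f → Poly d c (λ x → f (x + b))
  Poly-shift b (constant f≡) = constant (λ x → f≡ (x + b))
  Poly-shift {c = c} {f = f} b (horner a f′ P f≡) =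
    Poly-ext (Poly-add-const a (Poly-leading-cong (+-identityˡ c) (Poly-add (Poly-raise (Poly-scale b S)) (Poly-mulX S))))
      (λ x → sym (trans (f≡ (x + b)) (expand a x b (f′ (x + b)))))
    where
    S = Poly-shift b P
    expand : ∀ a x b u → a + (x + b) * u ≡ a + (b * u + x * u)
    expand = solve-∀ ℚ-ring

  -- Step-2 antidifferences

  Δ₂ : (ℚ → ℚ) → ℚ → ℚ
  Δ₂ f y = f (y + 2ℚ) - f y

  Poly-Δ₂ : Poly (suc d) c f → Poly d (2ℚ * ℕtoℚ (suc d) * c) (Δ₂ f)
  Poly-Δ₂ {zero} {c} {f} (horner a f′ (constant f′≡c) f≡) = constant λ y → begin
    f (y + 2ℚ) - f y                               ≡⟨ cong₂ _-_ (f≡ (y + 2ℚ)) (f≡ y) ⟩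
    (a + (y + 2ℚ) * f′ (y + 2ℚ)) - (a + y * f′ y)  ≡⟨ cong₂ (λ u v → (a + (y + 2ℚ) * u) - (a + y * v)) (f′≡c (y + 2ℚ)) (f′≡c y) ⟩
    (a + (y + 2ℚ) * c) - (a + y * c)               ≡⟨ linear a y c ⟩
    2ℚ * 1ℚ * c                                    ∎
    where
    open ≡-Reasoning
    linear : ∀ a y c → (a + (y + 2ℚ) * c) - (a + y * c) ≡ 2ℚ * 1ℚ * c
    linear = solve-∀ ℚ-ring
  Poly-Δ₂ {suc d} {c} {f} (horner a f′ P f≡) =
    Poly-leading-cong (trans (collect (ℕtoℚ (suc d)) c) (cong (λ n → 2ℚ * n * c) (sym (ℕtoℚ-suc (suc d)))))
      (Poly-ext (Poly-add (Poly-mulX (Poly-Δ₂ P)) (Poly-scale 2ℚ (Poly-shift 2ℚ P))) difference)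
    where
    collect : ∀ n c → 2ℚ * n * c + 2ℚ * c ≡ 2ℚ * (n + 1ℚ) * c
    collect = solve-∀ ℚ-ring
    product-rule : ∀ a y u v → (a + (y + 2ℚ) * u) - (a + y * v) ≡ y * (u - v) + 2ℚ * u
    product-rule = solve-∀ ℚ-ring
    difference : ∀ y → y * Δ₂ f′ y + 2ℚ * f′ (y + 2ℚ) ≡ Δ₂ f y
    difference y = sym (trans (cong₂ _-_ (f≡ (y + 2ℚ)) (f≡ y)) (product-rule a y (f′ (y + 2ℚ)) (f′ y)))

  record Antidifference (a : ℚ → ℚ) (d : ℕ) (c : ℚ) : Set where
    constructor antidiff
    field
      F    : ℚ → ℚ
      poly : Poly d c F
      step : ∀ y → F (y + 2ℚ) ≡ F y + a y

  antidifference : ∀ {d α a} → Poly d α a → Antidifference a (suc d) (α * (½ * 1/suc d))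
  antidifference-lower : ∀ {d r} → Poly d 0ℚ r → Antidifference r (suc d) 0ℚ

  antidifference {d} {α} {a} Pa = antidiff (λ y → μ y + R y) PF step
    where
    κ = α * (½ * 1/suc d)
    μ : ℚ → ℚ
    μ y = κ * y ^ suc d
    Pμ : Poly (suc d) κ μ
    Pμ = Poly-leading-cong (*-identityʳ κ) (Poly-scale κ (Poly-^ (suc d)))
    leading-cancels : α - 2ℚ * ℕtoℚ (suc d) * κ ≡ 0ℚ
    leading-cancels = begin
      α - 2ℚ * ℕtoℚ (suc d) * (α * (½ * 1/suc d))   ≡⟨ regroup α (ℕtoℚ (suc d)) (1/suc d) ⟩
      α - α * (ℕtoℚ (suc d) * 1/suc d)              ≡⟨ cong (λ z → α - α * z) (1/suc-inverseʳ d) ⟩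
      α - α * 1ℚ                                    ≡⟨ cancel α ⟩
      0ℚ                                            ∎
      where
      open ≡-Reasoning
      regroup : ∀ α n i → α - 2ℚ * n * (α * (½ * i)) ≡ α - α * (n * i)
      regroup = solve-∀ ℚ-ring
      cancel : ∀ α → α - α * 1ℚ ≡ 0ℚ
      cancel = solve-∀ ℚ-ring
    remainder = antidifference-lower (Poly-leading-cong leading-cancels (Poly-sub Pa (Poly-Δ₂ Pμ)))
    open Antidifference remainder renaming (F to R; poly to PR; step to R-step)
    PF : Poly (suc d) (α * (½ * 1/suc d)) (λ y → μ y + R y)
    PF = Poly-leading-cong (+-identityʳ κ) (Poly-add Pμ PR)
    step : ∀ y → μ (y + 2ℚ) + R (y + 2ℚ) ≡ (μ y + R y) + a y
    step y = trans (cong (μ (y + 2ℚ) +_) (R-step y)) (telescope (μ (y + 2ℚ)) (μ y) (R y) (a y))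
      where telescope : ∀ u v r w → u + (r + (w - (u - v))) ≡ (v + r) + w
            telescope = solve-∀ ℚ-ring

  antidifference-lower {zero}  (constant r≡0) =
    antidiff (λ _ → 0ℚ) (Poly-raise (Poly-const 0ℚ)) (λ y → sym (cong (0ℚ +_) (r≡0 y)))
  antidifference-lower {suc d} Pr = antidiff F (Poly-raise poly) step
    where open Antidifference (antidifference (proj₂ (Poly-lower Pr)))

  -- β A d = A! d! / (2 (A + d + 1)!) = B(A + 1, d + 1) / 2, the leading coefficient in n of
  -- the sum of i ^ A * (n - i) ^ d over the i ≤ n of one parity.
  β : ℕ → ℕ → ℚ
  β A zero    = ½ * 1/suc A
  β A (suc d) = β A d - β (suc A) d

  ratio : ℕ → ℕ → ℚ
  ratio a b = ℕtoℚ (suc a) * 1/suc (suc (a ℕ.+ b))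

  ratio-complement : ∀ a b → 1ℚ - ratio a b ≡ ℕtoℚ (suc b) * 1/suc (suc (a ℕ.+ b))
  ratio-complement a b = begin
    1ℚ - ℕtoℚ (suc a) * i                             ≡⟨ cong (λ z → z - ℕtoℚ (suc a) * i) (sym (1/suc-inverseʳ (suc (a ℕ.+ b)))) ⟩
    ℕtoℚ (suc (suc (a ℕ.+ b))) * i - ℕtoℚ (suc a) * i ≡⟨ cong (λ z → z * i - ℕtoℚ (suc a) * i) sum ⟩
    (ℕtoℚ (suc a) + ℕtoℚ (suc b)) * i - ℕtoℚ (suc a) * i ≡⟨ cancel (ℕtoℚ (suc a)) (ℕtoℚ (suc b)) i ⟩
    ℕtoℚ (suc b) * i                                  ∎
    where
    open ≡-Reasoning
    i = 1/suc (suc (a ℕ.+ b))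
    sum : ℕtoℚ (suc (suc (a ℕ.+ b))) ≡ ℕtoℚ (suc a) + ℕtoℚ (suc b)
    sum = trans (cong (ℕtoℚ ∘ suc) (sym (ℕ.+-suc a b))) (ℕtoℚ-+ (suc a) (suc b))
    cancel : ∀ x y i → (x + y) * i - x * i ≡ y * i
    cancel = solve-∀ ℚ-ring

  β-suc-left : ∀ A d → β (suc A) d ≡ β A d * ratio A d
  β-suc-left A zero rewrite ℕ.+-identityʳ A = sym (begin
    ½ * 1/suc A * (ℕtoℚ (suc A) * 1/suc (suc A))   ≡⟨ exchange (1/suc A) (ℕtoℚ (suc A)) (1/suc (suc A)) ⟩
    ½ * 1/suc (suc A) * (ℕtoℚ (suc A) * 1/suc A)   ≡⟨ cong (½ * 1/suc (suc A) *_) (1/suc-inverseʳ A) ⟩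
    ½ * 1/suc (suc A) * 1ℚ                         ≡⟨ *-identityʳ (½ * 1/suc (suc A)) ⟩
    ½ * 1/suc (suc A)                              ∎)
    where
    open ≡-Reasoning
    exchange : ∀ i n j → ½ * i * (n * j) ≡ ½ * j * (n * i)
    exchange = solve-∀ ℚ-ring
  β-suc-left A (suc d) = begin
    β (suc A) d - β (suc (suc A)) d         ≡⟨ cong₂ _-_ (β-suc-left A d) (trans (β-suc-left (suc A) d) (cong (_* ratio (suc A) d) (β-suc-left A d))) ⟩
    B * r - B * r * r′                      ≡⟨ factor B r r′ ⟩
    B * r * (1ℚ - r′)                       ≡⟨ cong (B * r *_) (ratio-complement (suc A) d) ⟩
    B * r * (ℕtoℚ (suc d) * 1/suc (suc (suc (A ℕ.+ d)))) ≡⟨ exchange B (ℕtoℚ (suc A)) (ℕtoℚ (suc d)) (1/suc (suc (A ℕ.+ d))) (1/suc (suc (suc (A ℕ.+ d)))) ⟩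
    B * (ℕtoℚ (suc d) * 1/suc (suc (A ℕ.+ d))) * (ℕtoℚ (suc A) * 1/suc (suc (suc (A ℕ.+ d))))
                                            ≡⟨ cong₂ (λ u v → B * u * (ℕtoℚ (suc A) * 1/suc v)) (sym (ratio-complement A d)) (cong suc (sym (ℕ.+-suc A d))) ⟩
    B * (1ℚ - r) * ratio A (suc d)          ≡⟨ expand B r (ratio A (suc d)) ⟩
    (B - B * r) * ratio A (suc d)           ≡⟨ cong (λ z → (B - z) * ratio A (suc d)) (β-suc-left A d) ⟨
    (β A d - β (suc A) d) * ratio A (suc d) ∎
    where
    open ≡-Reasoning
    B = β A d
    r = ratio A d
    r′ = ratio (suc A) d
    factor : ∀ B r r′ → B * r - B * r * r′ ≡ B * r * (1ℚ - r′)
    factor = solve-∀ ℚ-ring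
    exchange : ∀ B a b i j → B * (a * i) * (b * j) ≡ B * (b * i) * (a * j)
    exchange = solve-∀ ℚ-ring
    expand : ∀ B r s → B * (1ℚ - r) * s ≡ (B - B * r) * s
    expand = solve-∀ ℚ-ring

  β-suc-right : ∀ A d → β A (suc d) ≡ β A d * (ℕtoℚ (suc d) * 1/suc (suc (A ℕ.+ d)))
  β-suc-right A d = begin
    β A d - β (suc A) d           ≡⟨ cong (λ z → β A d - z) (β-suc-left A d) ⟩
    β A d - β A d * ratio A d     ≡⟨ factor (β A d) (ratio A d) ⟩
    β A d * (1ℚ - ratio A d)      ≡⟨ cong (β A d *_) (ratio-complement A d) ⟩
    β A d * (ℕtoℚ (suc d) * 1/suc (suc (A ℕ.+ d))) ∎
    where
    open ≡-Reasoning
    factor : ∀ B r → B - B * r ≡ B * (1ℚ - r)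
    factor = solve-∀ ℚ-ring

  β-positive : ∀ A d → Positive (β A d)
  β-positive A zero    = pos*pos⇒pos ½ (1/suc A) {{1/suc-positive A}}
  β-positive A (suc d) = subst Positive (sym (β-suc-right A d))
    (pos*pos⇒pos (β A d) {{β-positive A d}} _
      {{pos*pos⇒pos (ℕtoℚ (suc d)) {{ℕtoℚ-suc-positive d}} _ {{1/suc-positive (suc (A ℕ.+ d))}}}})

  -- With x = n, the sum of a i * Q (n - i) over the i ≤ n of one parity telescopes to G n (n + b) - G n b′.
  record ConvolutionPrimitive (a Q : ℚ → ℚ) (D : ℕ) (c : ℚ) : Set where
    constructor convprim
    field
      G        : ℚ → ℚ → ℚ
      step     : ∀ x y → G x (y + 2ℚ) ≡ G x y + a y * Q (x - y)
      diagonal : ∀ b → Poly D c (λ x → G x (x + b))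
      vertical : ∀ b → Poly D 0ℚ (λ x → G x b)

  convolutionPrimitive-const : ∀ {γ Q A α a} → (∀ z → Q z ≡ γ) → Poly A α a →
    ConvolutionPrimitive a Q (suc (A ℕ.+ 0)) (α * γ * β A 0)
  convolutionPrimitive-const {γ} {Q} {A} {α} {a} Q≡γ Pa =
    convprim (λ _ y → γ * F y) step′ diagonal′ (λ b → Poly-raise-by A (Poly-const (γ * F b)))
    where
    open Antidifference (antidifference Pa)
    step′ : ∀ x y → γ * F (y + 2ℚ) ≡ γ * F y + a y * Q (x - y)
    step′ x y = begin
      γ * F (y + 2ℚ)          ≡⟨ cong (γ *_) (step y) ⟩
      γ * (F y + a y)         ≡⟨ distrib γ (F y) (a y) ⟩
      γ * F y + a y * γ       ≡⟨ cong (λ z → γ * F y + a y * z) (Q≡γ (x - y)) ⟨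
      γ * F y + a y * Q (x - y) ∎
      where
      open ≡-Reasoning
      distrib : ∀ g u v → g * (u + v) ≡ g * u + v * g
      distrib = solve-∀ ℚ-ring
    diagonal′ : ∀ b → Poly (suc (A ℕ.+ 0)) (α * γ * β A 0) (λ x → γ * F (x + b))
    diagonal′ b = Poly-degree-cong (cong suc (sym (ℕ.+-identityʳ A)))
      (Poly-leading-cong (reorder γ α (½ * 1/suc A)) (Poly-scale γ (Poly-shift b poly)))
      where reorder : ∀ g a i → g * (a * i) ≡ a * g * i
            reorder = solve-∀ ℚ-ring

  convolutionPrimitive-horner : ∀ {q₀ Q Q′ d γ A α a} → (∀ z → Q z ≡ q₀ + z * Q′ z) → Poly A α a →
    ConvolutionPrimitive a Q′ (suc (A ℕ.+ d)) (α * γ * β A d) →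
    ConvolutionPrimitive (λ y → y * a y) Q′ (suc (suc A ℕ.+ d)) (α * γ * β (suc A) d) →
    ConvolutionPrimitive a Q (suc (A ℕ.+ suc d)) (α * γ * β A (suc d))
  convolutionPrimitive-horner {q₀} {Q} {Q′} {d} {γ} {A} {α} {a} Q≡ Pa C₁ C₂ =
    convprim G step′ diagonal′ vertical′
    where
    open Antidifference (antidifference Pa)
    open ConvolutionPrimitive C₁ renaming (G to G₁; step to step₁; diagonal to diagonal₁; vertical to vertical₁)
    open ConvolutionPrimitive C₂ renaming (G to G₂; step to step₂; diagonal to diagonal₂; vertical to vertical₂)
    -- a y * Q (x - y) = q₀ * a y + x * (a y * Q′ (x - y)) - (y * a y) * Q′ (x - y)
    G : ℚ → ℚ → ℚ
    G x y = q₀ * F y + x * G₁ x y - G₂ x y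
    step′ : ∀ x y → G x (y + 2ℚ) ≡ G x y + a y * Q (x - y)
    step′ x y = begin
      q₀ * F (y + 2ℚ) + x * G₁ x (y + 2ℚ) - G₂ x (y + 2ℚ)
        ≡⟨ cong₂ _-_ (cong₂ (λ u v → q₀ * u + x * v) (step y) (step₁ x y)) (step₂ x y) ⟩
      q₀ * (F y + a y) + x * (G₁ x y + a y * Q′ (x - y)) - (G₂ x y + (y * a y) * Q′ (x - y))
        ≡⟨ regroup q₀ (F y) (a y) x (G₁ x y) (G₂ x y) (Q′ (x - y)) y ⟩
      G x y + a y * (q₀ + (x - y) * Q′ (x - y))
        ≡⟨ cong (λ z → G x y + a y * z) (Q≡ (x - y)) ⟨
      G x y + a y * Q (x - y) ∎
      where
      open ≡-Reasoning
      regroup : ∀ q f a x g₁ g₂ q′ y → q * (f + a) + x * (g₁ + a * q′) - (g₂ + (y * a) * q′)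
                                     ≡ (q * f + x * g₁ - g₂) + a * (q + (x - y) * q′)
      regroup = solve-∀ ℚ-ring
    degree-eq : suc (suc (A ℕ.+ d)) ≡ suc (A ℕ.+ suc d)
    degree-eq = cong suc (sym (ℕ.+-suc A d))
    diagonal′ : ∀ b → Poly (suc (A ℕ.+ suc d)) (α * γ * β A (suc d)) (λ x → G x (x + b))
    diagonal′ b = Poly-leading-cong (collect α γ (β A d) (β (suc A) d))
      (Poly-sub (Poly-add (Poly-degree-cong (cong suc (trans (ℕ.+-comm d (suc A)) (sym (ℕ.+-suc A d))))
                                        (Poly-raise-by d (Poly-scale q₀ (Poly-shift b poly))))
                      (Poly-degree-cong degree-eq (Poly-mulX (diagonal₁ b))))
              (Poly-degree-cong degree-eq (diagonal₂ b)))
      where collect : ∀ a g u v → (0ℚ + a * g * u) - a * g * v ≡ a * g * (u - v)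
            collect = solve-∀ ℚ-ring
    vertical′ : ∀ b → Poly (suc (A ℕ.+ suc d)) 0ℚ (λ x → G x b)
    vertical′ b =
      Poly-sub (Poly-add (Poly-degree-cong (cong suc (ℕ.+-identityʳ (A ℕ.+ suc d))) (Poly-raise-by (A ℕ.+ suc d) (Poly-const (q₀ * F b))))
                     (Poly-degree-cong degree-eq (Poly-mulX (vertical₁ b))))
             (Poly-degree-cong degree-eq (vertical₂ b))

  convolutionPrimitive : ∀ {d γ Q A α a} → Poly d γ Q → Poly A α a →
    ConvolutionPrimitive a Q (suc (A ℕ.+ d)) (α * γ * β A d)
  convolutionPrimitive (constant Q≡γ)       Pa = convolutionPrimitive-const Q≡γ Pa
  convolutionPrimitive (horner q₀ Q′ PQ′ Q≡) Pa =
    convolutionPrimitive-horner {q₀} Q≡ Pa (convolutionPrimitive PQ′ Pa) (convolutionPrimitive PQ′ (Poly-mulX Pa))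

  -- Parity

  %2-cases : ∀ n → n % 2 ≡ 0 ⊎ n % 2 ≡ 1
  %2-cases zero          = inj₁ refl
  %2-cases (suc zero)    = inj₂ refl
  %2-cases (suc (suc n)) = %2-cases n

  %2-suc : ∀ n → suc n % 2 ≡ 1 ∸ n % 2
  %2-suc zero          = refl
  %2-suc (suc zero)    = refl
  %2-suc (suc (suc n)) = %2-suc n

  %2-+-congʳ : ∀ a {u v} → u % 2 ≡ v % 2 → (a ℕ.+ u) % 2 ≡ (a ℕ.+ v) % 2
  %2-+-congʳ a {u} {v} u≡v = begin
    (a ℕ.+ u) % 2              ≡⟨ %-distribˡ-+ a u 2 ⟩
    (a % 2 ℕ.+ u % 2) % 2      ≡⟨ cong (λ r → (a % 2 ℕ.+ r) % 2) u≡v ⟩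
    (a % 2 ℕ.+ v % 2) % 2      ≡⟨ %-distribˡ-+ a v 2 ⟨
    (a ℕ.+ v) % 2              ∎
    where open ≡-Reasoning

  %2-+-congˡ : ∀ {u v} a → u % 2 ≡ v % 2 → (u ℕ.+ a) % 2 ≡ (v ℕ.+ a) % 2
  %2-+-congˡ {u} {v} a u≡v =
    trans (cong (_% 2) (ℕ.+-comm u a)) (trans (%2-+-congʳ a u≡v) (cong (_% 2) (ℕ.+-comm a v)))

  %2-double : ∀ a u → (a ℕ.+ (a ℕ.+ u)) % 2 ≡ u % 2
  %2-double a u = trans (cong (_% 2) (rearrange a u)) ([m+kn]%n≡m%n u a 2)
    where rearrange : ∀ a u → a ℕ.+ (a ℕ.+ u) ≡ u ℕ.+ a ℕ.* 2
          rearrange = ℕ-Solver.solve-∀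

  %2-+-cancelˡ : ∀ a {u v} → (a ℕ.+ u) % 2 ≡ (a ℕ.+ v) % 2 → u % 2 ≡ v % 2
  %2-+-cancelˡ a {u} {v} h = trans (sym (%2-double a u)) (trans (%2-+-congʳ a h) (%2-double a v))

  %2-∸ : ∀ {i n} s → i ≤ n → n % 2 ≡ (i ℕ.+ s) % 2 → (n ∸ i) % 2 ≡ s % 2
  %2-∸ {i} {n} s i≤n parity = %2-+-cancelˡ i {n ∸ i} {s} (trans (cong (_% 2) (ℕ.m+[n∸m]≡n i≤n)) parity)

  %2-+-swap : ∀ a {n s} → n % 2 ≡ (a ℕ.+ s) % 2 → (a ℕ.+ n) % 2 ≡ s % 2
  %2-+-swap a {n} {s} parity = trans (%2-+-congʳ a {n} {a ℕ.+ s} parity) (%2-double a s)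

  %2-+-move : ∀ a {n s} → n % 2 ≡ (a ℕ.+ s) % 2 → (n ℕ.+ s) % 2 ≡ a % 2
  %2-+-move a {n} {s} parity = begin
    (n ℕ.+ s) % 2             ≡⟨ %2-+-congˡ {n} {a ℕ.+ s} s parity ⟩
    (a ℕ.+ s ℕ.+ s) % 2       ≡⟨ cong (_% 2) (rearrange a s) ⟩
    (a ℕ.+ s ℕ.* 2) % 2       ≡⟨ [m+kn]%n≡m%n a s 2 ⟩
    a % 2                     ∎
    where
    open ≡-Reasoning
    rearrange : ∀ a s → a ℕ.+ s ℕ.+ s ≡ a ℕ.+ s ℕ.* 2
    rearrange = ℕ-Solver.solve-∀

  toℕ-%2 : (e : Fin 2) → toℕ e % 2 ≡ toℕ e
  toℕ-%2 fzero        = refl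
  toℕ-%2 (fsuc fzero) = refl

  sumFrom1ℚ : ℕ → (ℕ → ℚ) → ℚ
  sumFrom1ℚ zero    g = 0ℚ
  sumFrom1ℚ (suc n) g = sumFrom1ℚ n g + g (suc n)

  ℕtoℚ-sumFrom1 : ∀ n f → ℕtoℚ (sumFrom1 n f) ≡ sumFrom1ℚ n (ℕtoℚ ∘ f)
  ℕtoℚ-sumFrom1 zero    f = refl
  ℕtoℚ-sumFrom1 (suc n) f = trans (ℕtoℚ-+ (sumFrom1 n f) (f (suc n))) (cong (_+ ℕtoℚ (f (suc n))) (ℕtoℚ-sumFrom1 n f))

  sumFrom1ℚ-cong : ∀ n {g g′ : ℕ → ℚ} → (∀ i → i ≤ n → g i ≡ g′ i) → sumFrom1ℚ n g ≡ sumFrom1ℚ n g′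
  sumFrom1ℚ-cong zero    g≡g′ = refl
  sumFrom1ℚ-cong (suc n) g≡g′ = cong₂ _+_ (sumFrom1ℚ-cong n (λ i i≤n → g≡g′ i (ℕ.m≤n⇒m≤1+n i≤n))) (g≡g′ (suc n) ℕ.≤-refl)

  restrict : Fin 2 → (ℚ → ℚ) → ℕ → ℚ
  restrict e h i = if i % 2 ≡ᵇ toℕ e then h (ℕtoℚ i) else 0ℚ

  restrict-suc : ∀ e h n → restrict e h (suc n) ≡ (if (toℕ e ℕ.+ n) % 2 ≡ᵇ 1 then h (ℕtoℚ (suc n)) else 0ℚ)
  restrict-suc fzero        h n = cong (λ b → if b then h (ℕtoℚ (suc n)) else 0ℚ) (condition (%2-cases n))
    where
    condition : n % 2 ≡ 0 ⊎ n % 2 ≡ 1 → (suc n % 2 ≡ᵇ 0) ≡ (n % 2 ≡ᵇ 1)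
    condition (inj₁ r≡0) rewrite %2-suc n | r≡0 = refl
    condition (inj₂ r≡1) rewrite %2-suc n | r≡1 = refl
  restrict-suc (fsuc fzero) h n = refl

  -- The last index i ≤ n with i ≡ e is n - (e + n) % 2 (if any), whence the upper end.
  telescope : ∀ (H h : ℚ → ℚ) → (∀ y → H (y + 2ℚ) ≡ H y + h y) → ∀ e n →
    sumFrom1ℚ n (restrict e h) ≡ H (ℕtoℚ n + (2ℚ - ℕtoℚ ((toℕ e ℕ.+ n) % 2))) - H (2ℚ - ℕtoℚ (toℕ e))
  telescope H h H-step fzero        zero = sym (+-inverseʳ (H 2ℚ))
  telescope H h H-step (fsuc fzero) zero = sym (+-inverseʳ (H 1ℚ))
  telescope H h H-step e (suc n) = extend (%2-cases (toℕ e ℕ.+ n)) (telescope H h H-step e n)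
    where
    open ≡-Reasoning
    x = ℕtoℚ n
    y = ℕtoℚ (suc n)
    B = H (2ℚ - ℕtoℚ (toℕ e))
    r = (toℕ e ℕ.+ n) % 2
    S = sumFrom1ℚ n (restrict e h)
    parity-suc : (toℕ e ℕ.+ suc n) % 2 ≡ 1 ∸ r
    parity-suc = trans (cong (_% 2) (ℕ.+-suc (toℕ e) n)) (%2-suc (toℕ e ℕ.+ n))
    x+1≡y : x + 1ℚ ≡ y
    x+1≡y = sym (ℕtoℚ-suc n)
    shift₀ : ∀ x → x + (2ℚ - 0ℚ) ≡ (x + 1ℚ) + (2ℚ - 1ℚ)
    shift₀ = solve-∀ ℚ-ring
    shift₁ : ∀ x → x + (2ℚ - 1ℚ) ≡ x + 1ℚ
    shift₁ = solve-∀ ℚ-ring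
    swap : ∀ u b v → u - b + v ≡ (u + v) - b
    swap = solve-∀ ℚ-ring
    extend : r ≡ 0 ⊎ r ≡ 1 → S ≡ H (x + (2ℚ - ℕtoℚ r)) - B →
             S + restrict e h (suc n) ≡ H (y + (2ℚ - ℕtoℚ ((toℕ e ℕ.+ suc n) % 2))) - B
    extend (inj₁ r≡0) ih = begin
      S + restrict e h (suc n)
        ≡⟨ cong₂ _+_ ih (trans (restrict-suc e h n) (cong (λ r → if r ≡ᵇ 1 then h y else 0ℚ) r≡0)) ⟩
      H (x + (2ℚ - ℕtoℚ r)) - B + 0ℚ   ≡⟨ +-identityʳ _ ⟩
      H (x + (2ℚ - ℕtoℚ r)) - B        ≡⟨ cong (λ r → H (x + (2ℚ - ℕtoℚ r)) - B) r≡0 ⟩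
      H (x + (2ℚ - 0ℚ)) - B            ≡⟨ cong (λ z → H z - B) (trans (shift₀ x) (cong (_+ (2ℚ - 1ℚ)) x+1≡y)) ⟩
      H (y + (2ℚ - 1ℚ)) - B            ≡⟨ cong (λ r → H (y + (2ℚ - ℕtoℚ r)) - B) (trans parity-suc (cong (1 ∸_) r≡0)) ⟨
      H (y + (2ℚ - ℕtoℚ ((toℕ e ℕ.+ suc n) % 2))) - B ∎
    extend (inj₂ r≡1) ih = begin
      S + restrict e h (suc n)
        ≡⟨ cong₂ _+_ ih (trans (restrict-suc e h n) (cong (λ r → if r ≡ᵇ 1 then h y else 0ℚ) r≡1)) ⟩
      H (x + (2ℚ - ℕtoℚ r)) - B + h y  ≡⟨ cong (λ r → H (x + (2ℚ - ℕtoℚ r)) - B + h y) r≡1 ⟩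
      H (x + (2ℚ - 1ℚ)) - B + h y      ≡⟨ cong (λ z → H z - B + h y) (trans (shift₁ x) x+1≡y) ⟩
      H y - B + h y                    ≡⟨ swap (H y) B (h y) ⟩
      (H y + h y) - B                  ≡⟨ cong (_- B) (H-step y) ⟨
      H (y + 2ℚ) - B                   ≡⟨ cong (λ z → H (y + z) - B) (+-identityʳ 2ℚ) ⟨
      H (y + (2ℚ - 0ℚ)) - B            ≡⟨ cong (λ r → H (y + (2ℚ - ℕtoℚ r)) - B) (trans parity-suc (cong (1 ∸_) r≡1)) ⟨
      H (y + (2ℚ - ℕtoℚ ((toℕ e ℕ.+ suc n) % 2))) - B ∎

  -- Oddness

  self-negation : ∀ z → z ≡ - z → z ≡ 0ℚ
  self-negation z z≡-z = begin
    z               ≡⟨ halve z ⟩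
    (z + z) * ½     ≡⟨ cong (λ u → (z + u) * ½) z≡-z ⟩
    (z + - z) * ½   ≡⟨ cancel z ⟩
    0ℚ              ∎
    where
    open ≡-Reasoning
    halve : ∀ z → z ≡ (z + z) * ½
    halve = solve-∀ ℚ-ring
    cancel : ∀ z → (z + - z) * ½ ≡ 0ℚ
    cancel = solve-∀ ℚ-ring

  odd-zero : ∀ {f : ℚ → ℚ} → (∀ y → f (- y) ≡ - f y) → f 0ℚ ≡ 0ℚ
  odd-zero {f} f-odd = self-negation (f 0ℚ) (f-odd 0ℚ)

  periodic₂-%2 : ∀ {c : ℚ → ℚ} → (∀ y → c (y + 2ℚ) ≡ c y) → ∀ u → c (ℕtoℚ u) ≡ c (ℕtoℚ (u % 2))
  periodic₂-%2     c-per zero          = refl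
  periodic₂-%2     c-per (suc zero)    = refl
  periodic₂-%2 {c} c-per (suc (suc u)) = trans (cong c (ℕtoℚ-2+ u)) (trans (c-per (ℕtoℚ u)) (periodic₂-%2 c-per u))

  module Oddness (G : ℚ → ℚ → ℚ) (a Q : ℚ → ℚ) (G-step : ∀ x y → G x (y + 2ℚ) ≡ G x y + a y * Q (x - y))
           (a-odd : ∀ y → a (- y) ≡ - a y) (Q-odd : ∀ z → Q (- z) ≡ - Q z) where

    -- By oddness of a and Q, both G x and y ↦ - G (- x) (2 - y) are step-2 antidifferences of
    -- y ↦ a y * Q (x - y), so they differ by a 2-periodic function.
    reflection-defect : ℚ → ℚ → ℚ
    reflection-defect x y = - G (- x) (2ℚ - y) - G x y

    reflection-defect-periodic : ∀ x y → reflection-defect x (y + 2ℚ) ≡ reflection-defect x y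
    reflection-defect-periodic x y = begin
      - G (- x) (2ℚ - (y + 2ℚ)) - G x (y + 2ℚ)
        ≡⟨ cong₂ (λ u v → - G (- x) u - v) (reflect₁ y) (G-step x y) ⟩
      - G (- x) (- y) - (G x y + a y * Q (x - y))
        ≡⟨ regroup (G (- x) (- y)) (G x y) (a y) (Q (x - y)) ⟩
      - (G (- x) (- y) + (- a y) * (- Q (x - y))) - G x y
        ≡⟨ cong (λ u → - u - G x y) mirrored-step ⟨
      - G (- x) (2ℚ - y) - G x y ∎
      where
      open ≡-Reasoning
      reflect₁ : ∀ y → 2ℚ - (y + 2ℚ) ≡ - y
      reflect₁ = solve-∀ ℚ-ring
      reflect₂ : ∀ y → 2ℚ - y ≡ - y + 2ℚ
      reflect₂ = solve-∀ ℚ-ring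
      reflect₃ : ∀ x y → - x - - y ≡ - (x - y)
      reflect₃ = solve-∀ ℚ-ring
      regroup : ∀ g h a q → - g - (h + a * q) ≡ - (g + (- a) * (- q)) - h
      regroup = solve-∀ ℚ-ring
      mirrored-step : G (- x) (2ℚ - y) ≡ G (- x) (- y) + (- a y) * (- Q (x - y))
      mirrored-step = begin
        G (- x) (2ℚ - y)                        ≡⟨ cong (G (- x)) (reflect₂ y) ⟩
        G (- x) (- y + 2ℚ)                      ≡⟨ G-step (- x) (- y) ⟩
        G (- x) (- y) + a (- y) * Q (- x - - y) ≡⟨ cong₂ (λ u v → G (- x) (- y) + u * v) (a-odd y) (trans (cong Q (reflect₃ x y)) (Q-odd (x - y))) ⟩
        G (- x) (- y) + (- a y) * (- Q (x - y)) ∎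

    G-diagonal-parity : ∀ ρ → ρ < 2 → ∀ x → G x (x + (2ℚ - ℕtoℚ ρ)) ≡ G x (x + ℕtoℚ ρ)
    G-diagonal-parity zero          _ x = begin
      G x (x + (2ℚ - 0ℚ))      ≡⟨ cong (G x) (+-identityʳ-2 x) ⟩
      G x (x + 2ℚ)             ≡⟨ G-step x x ⟩
      G x x + a x * Q (x - x)  ≡⟨ cong (λ z → G x x + a x * Q z) (+-inverseʳ x) ⟩
      G x x + a x * Q 0ℚ       ≡⟨ cong (λ z → G x x + a x * z) (odd-zero Q-odd) ⟩
      G x x + a x * 0ℚ         ≡⟨ +-*-zeroʳ (G x x) (a x) ⟩
      G x x                    ≡⟨ cong (G x) (+-identityʳ x) ⟨
      G x (x + 0ℚ)             ∎
      where
      open ≡-Reasoning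
      +-identityʳ-2 : ∀ x → x + (2ℚ - 0ℚ) ≡ x + 2ℚ
      +-identityʳ-2 = solve-∀ ℚ-ring
    G-diagonal-parity (suc zero)    _ x = refl
    G-diagonal-parity (suc (suc _)) (s≤s (s≤s ()))

    G-vertical-parity : ∀ e → e < 2 → ∀ x → G x (2ℚ - ℕtoℚ e) ≡ G x (ℕtoℚ e)
    G-vertical-parity zero          _ x = begin
      G x 2ℚ                         ≡⟨ G-step x 0ℚ ⟩
      G x 0ℚ + a 0ℚ * Q (x - 0ℚ)     ≡⟨ cong (λ z → G x 0ℚ + z * Q (x - 0ℚ)) (odd-zero a-odd) ⟩
      G x 0ℚ + 0ℚ * Q (x - 0ℚ)       ≡⟨ cong (G x 0ℚ +_) (*-zeroˡ (Q (x - 0ℚ))) ⟩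
      G x 0ℚ + 0ℚ                    ≡⟨ +-identityʳ (G x 0ℚ) ⟩
      G x 0ℚ                         ∎
      where open ≡-Reasoning
    G-vertical-parity (suc zero)    _ x = refl
    G-vertical-parity (suc (suc _)) (s≤s (s≤s ()))

    telescoped : ℕ → ℕ → ℚ → ℚ
    telescoped e ρ z = G z (z + (2ℚ - ℕtoℚ ρ)) - G z (2ℚ - ℕtoℚ e)

    telescoped-odd : ∀ e ρ → e < 2 → ρ < 2 → ∀ n → (n ℕ.+ ρ) % 2 ≡ e % 2 →
                     telescoped e ρ (- ℕtoℚ n) ≡ - telescoped e ρ (ℕtoℚ n)
    telescoped-odd e ρ e<2 ρ<2 n parity = begin
      G (- x) (- x + (2ℚ - r)) - V       ≡⟨ cong (λ u → G (- x) u - V) (reflect x r) ⟩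
      U - V                              ≡⟨ rearrange U V X₁ X₂ ⟩
      ((- V - X₂) - (- U - X₁)) + (X₂ - X₁) ≡⟨ cong (λ z → (z - (- U - X₁)) + (X₂ - X₁)) defects-agree ⟨
      ((- U - X₁) - (- U - X₁)) + (X₂ - X₁) ≡⟨ collapse U X₁ X₂ ⟩
      - (X₁ - X₂)                        ≡⟨ cong₂ (λ u v → - (u - v)) (G-diagonal-parity ρ ρ<2 x) (G-vertical-parity e e<2 x) ⟨
      - telescoped e ρ x                 ∎
      where
      open ≡-Reasoning
      x = ℕtoℚ n
      r = ℕtoℚ ρ
      U = G (- x) (2ℚ - (x + r))
      V = G (- x) (2ℚ - ℕtoℚ e)
      X₁ = G x (x + r)
      X₂ = G x (ℕtoℚ e)
      reflect : ∀ x r → - x + (2ℚ - r) ≡ 2ℚ - (x + r)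
      reflect = solve-∀ ℚ-ring
      rearrange : ∀ U V X₁ X₂ → U - V ≡ ((- V - X₂) - (- U - X₁)) + (X₂ - X₁)
      rearrange = solve-∀ ℚ-ring
      collapse : ∀ U X₁ X₂ → ((- U - X₁) - (- U - X₁)) + (X₂ - X₁) ≡ - (X₁ - X₂)
      collapse = solve-∀ ℚ-ring
      defects-agree : - U - X₁ ≡ - V - X₂
      defects-agree = begin
        reflection-defect x (x + r)                ≡⟨ cong (reflection-defect x) (ℕtoℚ-+ n ρ) ⟨
        reflection-defect x (ℕtoℚ (n ℕ.+ ρ))       ≡⟨ periodic₂-%2 (reflection-defect-periodic x) (n ℕ.+ ρ) ⟩
        reflection-defect x (ℕtoℚ ((n ℕ.+ ρ) % 2)) ≡⟨ cong (reflection-defect x ∘ ℕtoℚ) parity ⟩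
        reflection-defect x (ℕtoℚ (e % 2))         ≡⟨ periodic₂-%2 (reflection-defect-periodic x) e ⟨
        reflection-defect x (ℕtoℚ e)               ∎

  coefficients : Poly d c f → Vec ℚ (suc d)
  coefficients {c = c} (constant _) = c ∷ []
  coefficients (horner a _ P _)     = a ∷ coefficients P

  coefficients-eval : (P : Poly d c f) → ∀ x → f x ≡ evalPoly (coefficients P) x
  coefficients-eval {c = c} (constant f≡c) x = trans (f≡c x) (sym (+-*-zeroʳ c x))
  coefficients-eval (horner a _ P f≡) x = trans (f≡ x) (cong (λ z → a + x * z) (coefficients-eval P x))

  coefficients-leading : (P : Poly d c f) → lookup (coefficients P) (fromℕ d) ≡ c
  coefficients-leading (constant _)     = refl
  coefficients-leading (horner _ _ P _) = coefficients-leading P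

  Poly-evalPoly : (v : Vec ℚ (suc d)) → Poly d (lookup v (fromℕ d)) (evalPoly v)
  Poly-evalPoly {zero}  (a ∷ []) = constant (λ x → +-*-zeroʳ a x)
  Poly-evalPoly {suc d} (a ∷ v)  = horner a (evalPoly v) (Poly-evalPoly v) (λ _ → refl)

  oddPart evenPart : ∀ {n} → Vec ℚ n → Vec ℚ n
  oddPart  []      = []
  oddPart  (a ∷ v) = 0ℚ ∷ evenPart v
  evenPart []      = []
  evenPart (a ∷ v) = a ∷ oddPart v

  lookup-oddPart-even : ∀ {n} (v : Vec ℚ n) i → toℕ i % 2 ≡ 0 → lookup (oddPart v) i ≡ 0ℚ
  lookup-evenPart-odd : ∀ {n} (v : Vec ℚ n) i → toℕ i % 2 ≡ 1 → lookup (evenPart v) i ≡ 0ℚ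
  lookup-oddPart-even (a ∷ v) fzero    _ = refl
  lookup-oddPart-even (a ∷ v) (fsuc i) h = lookup-evenPart-odd v i (%2-+-cancelˡ 1 {toℕ i} {1} h)
  lookup-evenPart-odd (a ∷ v) (fsuc i) h = lookup-oddPart-even v i (%2-+-cancelˡ 1 {toℕ i} {0} h)

  lookup-oddPart-odd : ∀ {n} (v : Vec ℚ n) i → toℕ i % 2 ≡ 1 → lookup (oddPart v) i ≡ lookup v i
  lookup-evenPart-even : ∀ {n} (v : Vec ℚ n) i → toℕ i % 2 ≡ 0 → lookup (evenPart v) i ≡ lookup v i
  lookup-oddPart-odd   (a ∷ v) (fsuc i) h = lookup-evenPart-even v i (%2-+-cancelˡ 1 {toℕ i} {0} h)
  lookup-evenPart-even (a ∷ v) fzero    _ = refl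
  lookup-evenPart-even (a ∷ v) (fsuc i) h = lookup-oddPart-odd v i (%2-+-cancelˡ 1 {toℕ i} {1} h)

  evalPoly-split : ∀ {n} (v : Vec ℚ n) x → evalPoly v x ≡ evalPoly (oddPart v) x + evalPoly (evenPart v) x
  evalPoly-split []      x = refl
  evalPoly-split (a ∷ v) x =
    trans (cong (λ z → a + x * z) (evalPoly-split v x)) (regroup a x (evalPoly (oddPart v) x) (evalPoly (evenPart v) x))
    where regroup : ∀ a x o e → a + x * (o + e) ≡ (0ℚ + x * e) + (a + x * o)
          regroup = solve-∀ ℚ-ring

  evalPoly-oddPart-odd : ∀ {n} (v : Vec ℚ n) x → evalPoly (oddPart v) (- x) ≡ - evalPoly (oddPart v) x
  evalPoly-evenPart-even : ∀ {n} (v : Vec ℚ n) x → evalPoly (evenPart v) (- x) ≡ evalPoly (evenPart v) x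
  evalPoly-oddPart-odd []      x = refl
  evalPoly-oddPart-odd (a ∷ v) x = trans (cong (λ z → 0ℚ + - x * z) (evalPoly-evenPart-even v x)) (sign x (evalPoly (evenPart v) x))
    where sign : ∀ x e → 0ℚ + - x * e ≡ - (0ℚ + x * e)
          sign = solve-∀ ℚ-ring
  evalPoly-evenPart-even []      x = refl
  evalPoly-evenPart-even (a ∷ v) x = trans (cong (λ z → a + - x * z) (evalPoly-oddPart-odd v x)) (sign a x (evalPoly (oddPart v) x))
    where sign : ∀ a x o → a + - x * - o ≡ a + x * o
          sign = solve-∀ ℚ-ring

  -- At a point where evalPoly v is odd, its even part vanishes.
  evalPoly-oddPart : ∀ {n} (v : Vec ℚ n) x → evalPoly v (- x) ≡ - evalPoly v x → evalPoly (oddPart v) x ≡ evalPoly v x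
  evalPoly-oddPart v x v-odd = begin
    O        ≡⟨ +-identityʳ O ⟨
    O + 0ℚ   ≡⟨ cong (O +_) E≡0 ⟨
    O + E    ≡⟨ evalPoly-split v x ⟨
    evalPoly v x ∎
    where
    open ≡-Reasoning
    O = evalPoly (oddPart v) x
    E = evalPoly (evenPart v) x
    E≡-E : E ≡ - E
    E≡-E = begin
      E                                  ≡⟨ evalPoly-evenPart-even v x ⟨
      evalPoly (evenPart v) (- x)        ≡⟨ cancel-odd (evalPoly (oddPart v) (- x)) _ O E (evalPoly-oddPart-odd v x) eq ⟩
      - E                                ∎
      where
      eq : evalPoly (oddPart v) (- x) + evalPoly (evenPart v) (- x) ≡ - (O + E)
      eq = trans (sym (evalPoly-split v (- x))) (trans v-odd (cong -_ (evalPoly-split v x)))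
      cancel-odd : ∀ o′ e′ o e → o′ ≡ - o → o′ + e′ ≡ - (o + e) → e′ ≡ - e
      cancel-odd o′ e′ o e o′≡ sum≡ = begin
        e′                 ≡⟨ isolate o′ e′ ⟩
        (o′ + e′) - o′     ≡⟨ cong₂ _-_ sum≡ o′≡ ⟩
        - (o + e) - - o    ≡⟨ simplify o e ⟩
        - e                ∎
        where
        isolate : ∀ o′ e′ → e′ ≡ (o′ + e′) - o′
        isolate = solve-∀ ℚ-ring
        simplify : ∀ o e → - (o + e) - - o ≡ - e
        simplify = solve-∀ ℚ-ring
    E≡0 : E ≡ 0ℚ
    E≡0 = self-negation E E≡-E

  oddPart-leading : (P : Poly d c f) → d % 2 ≡ 1 → lookup (oddPart (coefficients P)) (fromℕ d) ≡ c
  oddPart-leading {d} P d-odd =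
    trans (lookup-oddPart-odd (coefficients P) (fromℕ d) (subst (λ j → j % 2 ≡ 1) (sym (toℕ-fromℕ d)) d-odd))
          (coefficients-leading P)

  Poly-oddPart : (P : Poly d c f) → d % 2 ≡ 1 → Poly d c (evalPoly (oddPart (coefficients P)))
  Poly-oddPart P d-odd = Poly-leading-cong (oddPart-leading P d-odd) (Poly-evalPoly (oddPart (coefficients P)))

  oddPart-agrees : (P : Poly d c f) → ∀ x → f (- x) ≡ - f x → evalPoly (oddPart (coefficients P)) x ≡ f x
  oddPart-agrees P x f-odd = trans (evalPoly-oddPart (coefficients P) x v-odd) (sym (coefficients-eval P x))
    where
    v-odd : evalPoly (coefficients P) (- x) ≡ - evalPoly (coefficients P) x
    v-odd = trans (sym (coefficients-eval P (- x))) (trans f-odd (cong -_ (coefficients-eval P x)))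

  -- Counting compositions

  ^-odd : ∀ k → k % 2 ≡ 1 → ∀ y → (- y) ^ k ≡ - y ^ k
  ^-odd (suc zero)    _     y = sign y
    where sign : ∀ y → - y * 1ℚ ≡ - (y * 1ℚ)
          sign = solve-∀ ℚ-ring
  ^-odd (suc (suc k)) k-odd y = trans (cong (λ z → - y * (- y * z)) (^-odd k k-odd y)) (sign y (y ^ k))
    where sign : ∀ y p → - y * (- y * - p) ≡ - (y * (y * p))
          sign = solve-∀ ℚ-ring

  sumFrom1-zero : ∀ n f → (∀ i → i ≤ n → f i ≡ 0) → sumFrom1 n f ≡ 0
  sumFrom1-zero zero    f f≡0 = refl
  sumFrom1-zero (suc n) f f≡0 = cong₂ ℕ._+_ (sumFrom1-zero n f (λ i i≤n → f≡0 i (ℕ.m≤n⇒m≤1+n i≤n))) (f≡0 (suc n) ℕ.≤-refl)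

  if-*-zero : ∀ b u → (if b then u ℕ.* 0 else 0) ≡ 0
  if-*-zero true  u = ℕ.*-zeroʳ u
  if-*-zero false u = refl

  compSum-single : ∀ k e n → n % 2 ≡ toℕ e → compSum (suc k ∷ []) (e ∷ []) n ≡ n ℕ.^ suc k
  compSum-single k e zero    _      = refl
  compSum-single k e (suc n) parity = trans (cong (ℕ._+ summand (suc n)) (sumFrom1-zero n summand earlier)) last
    where
    summand : ℕ → ℕ
    summand i = if i % 2 ≡ᵇ toℕ e then i ℕ.^ suc k ℕ.* compSum [] [] (suc n ∸ i) else 0
    earlier : ∀ i → i ≤ n → summand i ≡ 0
    earlier i i≤n rewrite ℕ.+-∸-assoc 1 i≤n = if-*-zero (i % 2 ≡ᵇ toℕ e) (i ℕ.^ suc k)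
    last : summand (suc n) ≡ suc n ℕ.^ suc k
    last with suc n % 2 ≡ᵇ toℕ e | ℕ.≡⇒≡ᵇ _ _ parity
    ... | true  | _ rewrite ℕ.n∸n≡0 n = ℕ.*-identityʳ _
    ... | false | ()

  degree : ∀ {m} → Vec ℕ (suc m) → ℕ
  degree (k ∷ [])      = k
  degree (k ∷ k′ ∷ ks) = suc (k ℕ.+ degree (k′ ∷ ks))

  leading : ∀ {m} → Vec ℕ (suc m) → ℚ
  leading (k ∷ [])      = 1ℚ
  leading (k ∷ k′ ∷ ks) = leading (k′ ∷ ks) * β k (degree (k′ ∷ ks))

  record CompositionPolynomial {m} (ks : Vec ℕ (suc m)) (εs : Vec (Fin 2) (suc m)) : Set where
    field
      P      : ℚ → ℚ
      poly   : Poly (degree ks) (leading ks) P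
      odd    : ∀ z → P (- z) ≡ - P z
      counts : ∀ n → n % 2 ≡ εsum εs % 2 → ℕtoℚ (compSum ks εs n) ≡ P (ℕtoℚ n)

  compositionPolynomial-single : ∀ k → k % 2 ≡ 1 → ∀ e → CompositionPolynomial (k ∷ []) (e ∷ [])
  compositionPolynomial-single (suc k) k-odd e = record
    { P      = _^ suc k
    ; poly   = Poly-^ (suc k)
    ; odd    = ^-odd (suc k) k-odd
    ; counts = λ n parity → trans (cong ℕtoℚ (compSum-single k e n (parity′ n parity))) (ℕtoℚ-^ n (suc k))
    }
    where
    parity′ : ∀ n → n % 2 ≡ (toℕ e ℕ.+ 0) % 2 → n % 2 ≡ toℕ e
    parity′ n parity = trans parity (trans (cong (_% 2) (ℕ.+-identityʳ (toℕ e))) (toℕ-%2 e))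

  compositionPolynomial-cons : ∀ {m k k′} {ks : Vec ℕ m} → k % 2 ≡ 1 → degree (k ∷ k′ ∷ ks) % 2 ≡ 1 →
    ∀ e {εs} → CompositionPolynomial (k′ ∷ ks) εs → CompositionPolynomial (k ∷ k′ ∷ ks) (e ∷ εs)
  compositionPolynomial-cons {k = k} {k′} {ks} k-odd degree-odd e {εs} IH = record
    { P      = evalPoly (oddPart (coefficients PT))
    ; poly   = Poly-oddPart PT degree-odd
    ; odd    = evalPoly-oddPart-odd (coefficients PT)
    ; counts = λ n parity → trans (T-counts n parity) (sym (oddPart-agrees PT (ℕtoℚ n) (T-odd n parity)))
    }
    where
    open CompositionPolynomial IH renaming (P to Q; poly to PQ; odd to Q-odd; counts to Q-counts)
    open ConvolutionPrimitive (convolutionPrimitive PQ (Poly-^ k))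
    open Oddness G (_^ k) Q step (^-odd k k-odd) Q-odd
    s = εsum εs
    ρ = s % 2
    T : ℚ → ℚ
    T = telescoped (toℕ e) ρ
    PT : Poly (degree (k ∷ k′ ∷ ks)) (leading (k ∷ k′ ∷ ks)) T
    PT = Poly-leading-cong (simplify (leading (k′ ∷ ks)) (β k (degree (k′ ∷ ks))))
           (Poly-sub (diagonal (2ℚ - ℕtoℚ ρ)) (vertical (2ℚ - ℕtoℚ (toℕ e))))
      where simplify : ∀ g b → 1ℚ * g * b - 0ℚ ≡ g * b
            simplify = solve-∀ ℚ-ring
    T-odd : ∀ n → n % 2 ≡ (toℕ e ℕ.+ s) % 2 → T (- ℕtoℚ n) ≡ - T (ℕtoℚ n)
    T-odd n parity = telescoped-odd (toℕ e) ρ (toℕ<n e) (m%n<n s 2) n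
      (trans (%2-+-congʳ n {ρ} {s} (m%n%n≡m%n s 2)) (%2-+-move (toℕ e) {n} {s} parity))
    T-counts : ∀ n → n % 2 ≡ (toℕ e ℕ.+ s) % 2 → ℕtoℚ (compSum (k ∷ k′ ∷ ks) (e ∷ εs) n) ≡ T (ℕtoℚ n)
    T-counts n parity = begin
      ℕtoℚ (sumFrom1 n summand)                 ≡⟨ ℕtoℚ-sumFrom1 n summand ⟩
      sumFrom1ℚ n (ℕtoℚ ∘ summand)              ≡⟨ sumFrom1ℚ-cong n summand-restrict ⟩
      sumFrom1ℚ n (restrict e h)                ≡⟨ telescope (G x) h (step x) e n ⟩
      G x (x + (2ℚ - ℕtoℚ ((toℕ e ℕ.+ n) % 2))) - G x (2ℚ - ℕtoℚ (toℕ e))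
                                                ≡⟨ cong (λ r → G x (x + (2ℚ - ℕtoℚ r)) - G x (2ℚ - ℕtoℚ (toℕ e))) (%2-+-swap (toℕ e) {n} {s} parity) ⟩
      T x                                       ∎
      where
      open ≡-Reasoning
      x = ℕtoℚ n
      h : ℚ → ℚ
      h y = y ^ k * Q (x - y)
      summand : ℕ → ℕ
      summand i = if i % 2 ≡ᵇ toℕ e then i ℕ.^ k ℕ.* compSum (k′ ∷ ks) εs (n ∸ i) else 0
      summand-restrict : ∀ i → i ≤ n → ℕtoℚ (summand i) ≡ (if i % 2 ≡ᵇ toℕ e then h (ℕtoℚ i) else 0ℚ)
      summand-restrict i i≤n with i % 2 ≡ᵇ toℕ e in admissible
      ... | false = refl
      ... | true  = begin
        ℕtoℚ (i ℕ.^ k ℕ.* compSum (k′ ∷ ks) εs (n ∸ i))          ≡⟨ ℕtoℚ-* (i ℕ.^ k) _ ⟩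
        ℕtoℚ (i ℕ.^ k) * ℕtoℚ (compSum (k′ ∷ ks) εs (n ∸ i))     ≡⟨ cong₂ _*_ (ℕtoℚ-^ i k) (Q-counts (n ∸ i) rest-parity) ⟩
        ℕtoℚ i ^ k * Q (ℕtoℚ (n ∸ i))                            ≡⟨ cong (λ z → ℕtoℚ i ^ k * Q z) (ℕtoℚ-∸ i≤n) ⟩
        h (ℕtoℚ i)                                               ∎
        where
        i%2≡e : i % 2 ≡ toℕ e
        i%2≡e = ℕ.≡ᵇ⇒≡ (i % 2) (toℕ e) (subst Bool.T (sym admissible) _)
        rest-parity : (n ∸ i) % 2 ≡ s % 2
        rest-parity = %2-∸ s i≤n (trans parity (%2-+-congˡ {toℕ e} {i} s (trans (cong (_% 2) (sym i%2≡e)) (m%n%n≡m%n i 2))))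

  degree-odd : ∀ {m} (ks : Vec ℕ (suc m)) → All (λ k → k % 2 ≡ 1) ks → degree ks % 2 ≡ 1
  degree-odd (k ∷ [])      (k-odd ∷ [])   = k-odd
  degree-odd (k ∷ k′ ∷ ks) (k-odd ∷ rest) = trans (%2-suc (k ℕ.+ D)) (cong (1 ∸_) k+D-even)
    where
    D = degree (k′ ∷ ks)
    k+D-even : (k ℕ.+ D) % 2 ≡ 0
    k+D-even = trans (%2-+-congˡ {k} {1} D k-odd) (%2-+-congʳ 1 {D} {1} (degree-odd (k′ ∷ ks) rest))

  compositionPolynomial : ∀ {m} (ks : Vec ℕ (suc m)) → All (λ k → k % 2 ≡ 1) ks → ∀ εs → CompositionPolynomial ks εs
  compositionPolynomial (k ∷ [])      (k-odd ∷ [])   (e ∷ [])  = compositionPolynomial-single k k-odd e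
  compositionPolynomial (k ∷ k′ ∷ ks) (k-odd ∷ rest) (e ∷ εs) =
    compositionPolynomial-cons k-odd (degree-odd (k ∷ k′ ∷ ks) (k-odd ∷ rest)) e (compositionPolynomial (k′ ∷ ks) rest εs)

  degree-vsum : ∀ {m} (ks : Vec ℕ (suc m)) → degree ks ≡ vsum ks ℕ.+ m
  degree-vsum (k ∷ [])          = sym (trans (ℕ.+-identityʳ (k ℕ.+ 0)) (ℕ.+-identityʳ k))
  degree-vsum {suc m} (k ∷ k′ ∷ ks) = trans (cong (λ D → suc (k ℕ.+ D)) (degree-vsum (k′ ∷ ks))) (regroup k (vsum (k′ ∷ ks)) m)
    where regroup : ∀ k V m → suc (k ℕ.+ (V ℕ.+ m)) ≡ k ℕ.+ V ℕ.+ suc m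
          regroup = ℕ-Solver.solve-∀

  leading-positive : ∀ {m} (ks : Vec ℕ (suc m)) → Positive (leading ks)
  leading-positive (k ∷ [])      = _
  leading-positive (k ∷ k′ ∷ ks) = pos*pos⇒pos (leading (k′ ∷ ks)) {{leading-positive (k′ ∷ ks)}} _ {{β-positive k (degree (k′ ∷ ks))}}

  odd-coefficients : (P : Poly d c f) → d % 2 ≡ 1 → (∀ z → f (- z) ≡ - f z) → d ≡ d′ →
    Σ (Vec ℚ (suc d′)) λ p → lookup p (fromℕ d′) ≡ c × (∀ i → toℕ i % 2 ≡ 0 → lookup p i ≡ 0ℚ) × (∀ x → f x ≡ evalPoly p x)
  odd-coefficients P d-odd f-odd refl = oddPart (coefficients P) , oddPart-leading P d-odd , lookup-oddPart-even (coefficients P) , λ x → sym (oddPart-agrees P x (f-odd x))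

open import Data.Fin using (Fin; toℕ; fromℕ)
open import Data.Nat using (ℕ; suc; _+_; _∸_; _%_; _≤_)
import Data.Nat.Properties as ℕ
open import Data.Product using (Σ; ∃; _×_; _,_)
open import Data.Rational using (ℚ; 0ℚ)
open import Data.Rational.Properties using (<⇒≢; positive⁻¹)
open import Data.Vec using (Vec; lookup)
open import Data.Vec.Relation.Unary.All using (All)
open import Relation.Binary.PropositionalEquality using (_≡_; _≢_; sym; trans; cong)

open import Defs

proposition2p3 : (m : ℕ) → 1 ≤ m → (ks : Vec ℕ m) → All (λ k → k % 2 ≡ 1) ks →
  ∃ λ (c : ℚ) → c ≢ 0ℚ ×
    ((εs : Vec (Fin 2) m) →
      Σ (Vec ℚ (suc (vsum ks + m ∸ 1))) λ p →
        (lookup p (fromℕ (vsum ks + m ∸ 1)) ≡ c) ×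
        ((i : Fin (suc (vsum ks + m ∸ 1))) → toℕ i % 2 ≡ 0 → lookup p i ≡ 0ℚ) ×
        ((n : ℕ) → 1 ≤ n → n % 2 ≡ εsum εs % 2 →
          ℕtoℚ (compSum ks εs n) ≡ evalPoly p (ℕtoℚ n)))
proposition2p3 (suc m) _ ks ks-odd = leading ks , leading≢0 , λ εs →
  let open CompositionPolynomial (compositionPolynomial ks ks-odd εs)
      p , p-leading , p-odd , p-eval = odd-coefficients poly (degree-odd ks ks-odd) odd degree≡
  in  p , p-leading , p-odd , λ n _ parity → trans (counts n parity) (p-eval (ℕtoℚ n))
  where
  leading≢0 : leading ks ≢ 0ℚ
  leading≢0 c≡0 = <⇒≢ (positive⁻¹ (leading ks) {{leading-positive ks}}) (sym c≡0)
  degree≡ : degree ks ≡ vsum ks + suc m ∸ 1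
  degree≡ = trans (degree-vsum ks) (cong (_∸ 1) (sym (ℕ.+-suc (vsum ks) m)))
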